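{- Let $n\ge 6$ and $\pi=(d_1,d_2,3^{n-2})$ with $n-1\ge d_1\ge d_2\ge 3$, $d_1\ge 5$, and $\sigma(\pi)$ even. Then: (1) $\pi$ is graphic; (2) $\pi$ is potentially $K_6-C_5$-graphic provided all of the following hold: (i) if $n\ge 7$ and $n$ is even, then $\pi\ne((n-1)^2,3^{n-2})$ and $\pi\ne((n-2)^2,3^{n-2})$; (ii) if $n\ge 7$ and $n$ is odd, then $\pi\ne(n-1,n-2,3^{n-2})$; (iii) $\pi$ is none of $(5,3^7)$, $(5,4,3^5)$, $(5,4,3^7)$, $(5^2,3^4)$, $(5^2,3^6)$, $(6,3^6)$, $(6,3^8)$, $(7,3^7)$, $(6,4,3^6)$.
   Context: A non-increasing sequence of nonnegative integers is graphic if it is the degree sequence of a simple graph; it is potentially $H$-graphic if some such graph contains $H$ as a subgraph. $\sigma(\pi)$ is the sum of the terms of $\pi$. $r^t$ denotes $t$ terms equal to $r$. $K_6-C_5$ denotes $K_6$ with the edges of a 5-cycle on five of its vertices removed. -}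

module Defs where

open import Data.Nat using (ℕ; zero; suc; _+_; _*_; _∸_; _≤_; _≡ᵇ_)
open import Data.Nat.Divisibility using (_∣_)
open import Data.Bool using (Bool; true; false; if_then_else_; _∧_; not)
open import Data.Fin using (Fin; zero; suc; toℕ)
open import Data.List using (List; map; allFin; _∷_; [])
open import Data.Nat.ListAction using (sum)
open import Data.Product using (Σ; _×_; _,_; ∃)
open import Relation.Binary.PropositionalEquality using (_≡_; refl)
open import Function.Definitions using (Injective)

record Graph (n : ℕ) : Set where
  field
    adj   : Fin n → Fin n → Bool
    sym   : ∀ i j → adj i j ≡ adj j i
    irref : ∀ i → adj i i ≡ false
open Graph public

deg : ∀ {n} → Graph n → Fin n → ℕ
deg {n} G i = sum (map (λ j → if adj G i j then 1 else 0) (allFin n))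

IsDegreeSequenceOf : ∀ {n} → Graph n → (Fin n → ℕ) → Set
IsDegreeSequenceOf {n} G π = ∀ i → deg G i ≡ π i

Graphic : ∀ {n} → (Fin n → ℕ) → Set
Graphic {n} π = Σ (Graph n) λ G → IsDegreeSequenceOf G π

Subgraph : ∀ {k n} → Graph k → Graph n → Set
Subgraph {k} {n} H G =
  Σ (Fin k → Fin n) λ f → Injective _≡_ _≡_ f ×
    (∀ u v → adj H u v ≡ true → adj G (f u) (f v) ≡ true)

PotentiallyGraphic : ∀ {k n} → Graph k → (Fin n → ℕ) → Set
PotentiallyGraphic {k} {n} H π =
  Σ (Graph n) λ G → IsDegreeSequenceOf G π × Subgraph H G

cycEdge : ℕ → ℕ → Bool
cycEdge 0 1 = true
cycEdge 1 0 = true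
cycEdge 1 2 = true
cycEdge 2 1 = true
cycEdge 2 3 = true
cycEdge 3 2 = true
cycEdge 3 4 = true
cycEdge 4 3 = true
cycEdge 4 0 = true
cycEdge 0 4 = true
cycEdge _ _ = false

k6c5adj : Fin 6 → Fin 6 → Bool
k6c5adj i j = not (toℕ i ≡ᵇ toℕ j) ∧ not (cycEdge (toℕ i) (toℕ j))

k6c5sym : ∀ i j → k6c5adj i j ≡ k6c5adj j i
k6c5sym (zero) (zero) = refl
k6c5sym (zero) (suc (zero)) = refl
k6c5sym (zero) (suc (suc (zero))) = refl
k6c5sym (zero) (suc (suc (suc (zero)))) = refl
k6c5sym (zero) (suc (suc (suc (suc (zero))))) = refl
k6c5sym (zero) (suc (suc (suc (suc (suc (zero)))))) = refl
k6c5sym (suc (zero)) (zero) = refl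
k6c5sym (suc (zero)) (suc (zero)) = refl
k6c5sym (suc (zero)) (suc (suc (zero))) = refl
k6c5sym (suc (zero)) (suc (suc (suc (zero)))) = refl
k6c5sym (suc (zero)) (suc (suc (suc (suc (zero))))) = refl
k6c5sym (suc (zero)) (suc (suc (suc (suc (suc (zero)))))) = refl
k6c5sym (suc (suc (zero))) (zero) = refl
k6c5sym (suc (suc (zero))) (suc (zero)) = refl
k6c5sym (suc (suc (zero))) (suc (suc (zero))) = refl
k6c5sym (suc (suc (zero))) (suc (suc (suc (zero)))) = refl
k6c5sym (suc (suc (zero))) (suc (suc (suc (suc (zero))))) = refl
k6c5sym (suc (suc (zero))) (suc (suc (suc (suc (suc (zero)))))) = refl
k6c5sym (suc (suc (suc (zero)))) (zero) = refl
k6c5sym (suc (suc (suc (zero)))) (suc (zero)) = refl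
k6c5sym (suc (suc (suc (zero)))) (suc (suc (zero))) = refl
k6c5sym (suc (suc (suc (zero)))) (suc (suc (suc (zero)))) = refl
k6c5sym (suc (suc (suc (zero)))) (suc (suc (suc (suc (zero))))) = refl
k6c5sym (suc (suc (suc (zero)))) (suc (suc (suc (suc (suc (zero)))))) = refl
k6c5sym (suc (suc (suc (suc (zero))))) (zero) = refl
k6c5sym (suc (suc (suc (suc (zero))))) (suc (zero)) = refl
k6c5sym (suc (suc (suc (suc (zero))))) (suc (suc (zero))) = refl
k6c5sym (suc (suc (suc (suc (zero))))) (suc (suc (suc (zero)))) = refl
k6c5sym (suc (suc (suc (suc (zero))))) (suc (suc (suc (suc (zero))))) = refl
k6c5sym (suc (suc (suc (suc (zero))))) (suc (suc (suc (suc (suc (zero)))))) = refl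
k6c5sym (suc (suc (suc (suc (suc (zero)))))) (zero) = refl
k6c5sym (suc (suc (suc (suc (suc (zero)))))) (suc (zero)) = refl
k6c5sym (suc (suc (suc (suc (suc (zero)))))) (suc (suc (zero))) = refl
k6c5sym (suc (suc (suc (suc (suc (zero)))))) (suc (suc (suc (zero)))) = refl
k6c5sym (suc (suc (suc (suc (suc (zero)))))) (suc (suc (suc (suc (zero))))) = refl
k6c5sym (suc (suc (suc (suc (suc (zero)))))) (suc (suc (suc (suc (suc (zero)))))) = refl

k6c5irr : ∀ i → k6c5adj i i ≡ false
k6c5irr (zero) = refl
k6c5irr (suc (zero)) = refl
k6c5irr (suc (suc (zero))) = refl
k6c5irr (suc (suc (suc (zero)))) = refl
k6c5irr (suc (suc (suc (suc (zero))))) = refl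
k6c5irr (suc (suc (suc (suc (suc (zero)))))) = refl

K6-C5 : Graph 6
K6-C5 = record { adj = k6c5adj ; sym = k6c5sym ; irref = k6c5irr }

seqπ : (n d₁ d₂ : ℕ) → Fin n → ℕ
seqπ n d₁ d₂ i with toℕ i
... | 0 = d₁
... | 1 = d₂
... | _ = 3

σπ : (n d₁ d₂ : ℕ) → ℕ
σπ n d₁ d₂ = d₁ + d₂ + 3 * (n ∸ 2)

-- the nine exceptional sequences of (iii), recorded as triples (n, d₁, d₂)
exceptions : List (ℕ × ℕ × ℕ)
exceptions =
  (8 , 5 , 3) ∷
  (7 , 5 , 4) ∷
  (9 , 5 , 4) ∷
  (6 , 5 , 5) ∷
  (8 , 5 , 5) ∷
  (7 , 6 , 3) ∷
  (9 , 6 , 3) ∷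
  (8 , 7 , 3) ∷
  (8 , 6 , 4) ∷
  []

module Submission where

-- Realizations are grown from small seeds by gluing gadgets: small graphs whose
-- vertices all reach degree 3 and which are joined only to the two high-degree
-- vertices 0 and 1.  Gluing raises n, d₁, d₂ and never destroys a copy of K₆ − C₅
-- already present.  For n ≥ 14 one of three gadgets can be split off while keeping
-- every hypothesis (including non-exceptionality): K₄ if d₁ ≤ n − 7, an edge joined to
-- both high vertices if d₂ ≥ 5, a triangle joined to vertex 0 otherwise.  The finitely
-- many sequences with n ≤ 13 are realized by explicit recipes checked by evaluation.

open import Defs
open import Data.Bool using (Bool; true; false; if_then_else_; _∧_; _∨_)
open import Data.Bool.ListAction using (any)
open import Data.Bool.Properties using (T-≡) renaming (_≟_ to _≟ᵇ_)
open import Data.Fin using (Fin; toℕ; fromℕ<)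
open import Data.Fin.Properties using (all?; toℕ<n; toℕ-fromℕ<) renaming (_≟_ to _≟ᶠ_)
open import Data.List using (List; []; _∷_; tabulate)
open import Data.List.Membership.Propositional using (_∈_)
open import Data.List.Properties using (map-tabulate)
open import Data.List.Relation.Unary.All as All using (All)
open import Data.Nat using (ℕ; zero; suc; _+_; _*_; _∸_; _<_; _≤_; z≤n; s≤s; z<s; _<ᵇ_; _≡ᵇ_; _<?_; _≤?_; _≟_)
open import Data.Nat.Divisibility using (_∣_; _∣?_; divides; ∣-refl; ∣m+n∣m⇒∣n; ∣m∣n⇒∣m+n)
open import Data.Nat.Induction using (<-rec)
open import Data.Nat.ListAction using (sum)
open import Data.Nat.Properties
open import Data.Nat.Tactic.RingSolver using (solve-∀)
open import Data.Product using (∃; _×_; _,_; proj₁; proj₂)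
open import Data.Product.Properties using (≡-dec)
open import Data.Unit using (⊤; tt)
open import Data.Vec using (lookup) renaming (_∷_ to _∷ᵥ_; [] to []ᵥ)
open import Function using (_∘_; const; id; case_of_)
open import Function.Bundles using (Equivalence)
open import Relation.Nullary using (¬_)
open import Relation.Nullary.Decidable using (Dec; yes; no; map′; _×-dec_; _→-dec_; ¬?; True; toWitness)
open import Relation.Binary.PropositionalEquality hiding (sym)
import Relation.Binary.PropositionalEquality as ≡

bit : Bool → ℕ
bit b = if b then 1 else 0

count : ℕ → (ℕ → Bool) → ℕ
count zero    p = 0
count (suc n) p = bit (p 0) + count n (p ∘ suc)

count-cong : ∀ n {p q : ℕ → Bool} → (∀ {j} → j < n → p j ≡ q j) → count n p ≡ count n q
count-cong zero    p≗q = refl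
count-cong (suc n) p≗q = cong₂ _+_ (cong bit (p≗q (s≤s z≤n))) (count-cong n (p≗q ∘ s≤s))

count-+ : ∀ m n (p : ℕ → Bool) → count (m + n) p ≡ count m p + count n (λ t → p (m + t))
count-+ zero    n p = refl
count-+ (suc m) n p = trans (cong (bit (p 0) +_) (count-+ m n (p ∘ suc))) (≡.sym (+-assoc (bit (p 0)) _ _))

count-false : ∀ n → count n (const false) ≡ 0
count-false zero    = refl
count-false (suc n) = count-false n

profile : ℕ → ℕ → ℕ → ℕ
profile d₁ d₂ 0             = d₁
profile d₁ d₂ 1             = d₂
profile d₁ d₂ (suc (suc _)) = 3

-- Vertices are naturals rather than elements of Fin n, so that gluing can append vertices n + t.
record IsRealization (n d₁ d₂ : ℕ) (edge : ℕ → ℕ → Bool) : Set where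
  constructor mkIsRealization
  field
    edge-sym    : ∀ {i} → i < n → ∀ {j} → j < n → edge i j ≡ edge j i
    edge-irrefl : ∀ {i} → i < n → edge i i ≡ false
    degree      : ∀ {i} → i < n → count n (edge i) ≡ profile d₁ d₂ i

isRealization? : ∀ n d₁ d₂ edge → Dec (IsRealization n d₁ d₂ edge)
isRealization? n d₁ d₂ edge =
  map′ (λ { (s , r , d) → mkIsRealization (λ {i} → s {i}) (λ {i} → r {i}) (λ {i} → d {i}) })
       (λ { (mkIsRealization s r d) → (λ {i} → s {i}) , (λ {i} → r {i}) , (λ {i} → d {i}) })
    (  allUpTo? (λ i → allUpTo? (λ j → edge i j ≟ᵇ edge j i) n) n
    ×-dec allUpTo? (λ i → edge i i ≟ᵇ false) n
    ×-dec allUpTo? (λ i → count n (edge i) ≟ profile d₁ d₂ i) n)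

record IsEmbedding {k} (H : Graph k) (n : ℕ) (edge : ℕ → ℕ → Bool) (f : Fin k → ℕ) : Set where
  constructor mkIsEmbedding
  field
    bounded   : ∀ u → f u < n
    injective : ∀ u v → f u ≡ f v → u ≡ v
    preserves : ∀ u v → adj H u v ≡ true → edge (f u) (f v) ≡ true

isEmbedding? : ∀ {k} (H : Graph k) n edge f → Dec (IsEmbedding H n edge f)
isEmbedding? H n edge f =
  map′ (λ { (b , i , p) → mkIsEmbedding b i p }) (λ { (mkIsEmbedding b i p) → b , i , p })
    (  all? (λ u → f u <? n)
    ×-dec all? (λ u → all? (λ v → f u ≟ f v →-dec u ≟ᶠ v))
    ×-dec all? (λ u → all? (λ v → adj H u v ≟ᵇ true →-dec edge (f u) (f v) ≟ᵇ true)))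

record Realization {k} (H : Graph k) (n d₁ d₂ : ℕ) : Set where
  field
    edge          : ℕ → ℕ → Bool
    isRealization : IsRealization n d₁ d₂ edge
    embed         : Fin k → ℕ
    isEmbedding   : IsEmbedding H n edge embed
  open IsRealization isRealization public
  open IsEmbedding isEmbedding public

module _ {k} {H : Graph k} {n d₁ d₂} (r : Realization H n d₁ d₂) where
  open Realization r

  toGraph : Graph n
  toGraph = record
    { adj   = λ i j → edge (toℕ i) (toℕ j)
    ; sym   = λ i j → edge-sym (toℕ<n i) (toℕ<n j)
    ; irref = λ i → edge-irrefl (toℕ<n i)
    }

  isDegreeSequenceOf-toGraph : IsDegreeSequenceOf toGraph (seqπ n d₁ d₂)
  isDegreeSequenceOf-toGraph i = begin
    deg toGraph i            ≡⟨ cong sum (map-tabulate id row) ⟩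
    sum (tabulate row)       ≡⟨ sum-tabulate-bit n (edge (toℕ i)) ⟩
    count n (edge (toℕ i))   ≡⟨ degree (toℕ<n i) ⟩
    profile d₁ d₂ (toℕ i)    ≡⟨ profile-seqπ i ⟩
    seqπ n d₁ d₂ i           ∎
    where
    open ≡-Reasoning
    row : Fin n → ℕ
    row j = bit (edge (toℕ i) (toℕ j))
    sum-tabulate-bit : ∀ m (p : ℕ → Bool) → sum (tabulate {n = m} (λ j → bit (p (toℕ j)))) ≡ count m p
    sum-tabulate-bit zero    p = refl
    sum-tabulate-bit (suc m) p = cong (bit (p 0) +_) (sum-tabulate-bit m (p ∘ suc))
    profile-seqπ : ∀ i → profile d₁ d₂ (toℕ i) ≡ seqπ n d₁ d₂ i
    profile-seqπ i with toℕ i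
    ... | 0           = refl
    ... | 1           = refl
    ... | suc (suc _) = refl

  graphic : Graphic (seqπ n d₁ d₂)
  graphic = toGraph , isDegreeSequenceOf-toGraph

  potentiallyGraphic : PotentiallyGraphic H (seqπ n d₁ d₂)
  potentiallyGraphic = toGraph , isDegreeSequenceOf-toGraph , vertex , vertex-injective , vertex-preserves
    where
    vertex : Fin k → Fin n
    vertex u = fromℕ< (bounded u)
    toℕ-vertex : ∀ u → toℕ (vertex u) ≡ embed u
    toℕ-vertex u = toℕ-fromℕ< (bounded u)
    vertex-injective : ∀ {u v} → vertex u ≡ vertex v → u ≡ v
    vertex-injective {u} {v} e = injective u v (trans (≡.sym (toℕ-vertex u)) (trans (cong toℕ e) (toℕ-vertex v)))
    vertex-preserves : ∀ u v → adj H u v ≡ true → edge (toℕ (vertex u)) (toℕ (vertex v)) ≡ true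
    vertex-preserves u v e rewrite toℕ-vertex u | toℕ-vertex v = preserves u v e

-- Part (1) is proved with realizations containing the empty graph, so both parts share one construction.
edgeless : ∀ k → Graph k
edgeless k = record { adj = λ _ _ → false ; sym = λ _ _ → refl ; irref = λ _ → refl }

forget : ∀ {k} {H : Graph k} {n d₁ d₂} → Realization H n d₁ d₂ → Realization (edgeless 0) n d₁ d₂
forget r = record
  { edge = edge ; isRealization = isRealization ; embed = λ () ; isEmbedding = mkIsEmbedding (λ ()) (λ ()) (λ ()) }
  where open Realization r

-- Gluing gadgets

record IsCubic (k : ℕ) (inner : ℕ → ℕ → Bool) (to₀ to₁ : ℕ → Bool) : Set where
  constructor mkIsCubic
  field
    inner-sym    : ∀ {s} → s < k → ∀ {t} → t < k → inner s t ≡ inner t s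
    inner-irrefl : ∀ {t} → t < k → inner t t ≡ false
    cubic        : ∀ {t} → t < k → bit (to₀ t) + bit (to₁ t) + count k (inner t) ≡ 3

isCubic? : ∀ k inner to₀ to₁ → Dec (IsCubic k inner to₀ to₁)
isCubic? k inner to₀ to₁ =
  map′ (λ { (s , r , c) → mkIsCubic (λ {i} → s {i}) (λ {i} → r {i}) (λ {i} → c {i}) })
       (λ { (mkIsCubic s r c) → (λ {i} → s {i}) , (λ {i} → r {i}) , (λ {i} → c {i}) })
    (  allUpTo? (λ s → allUpTo? (λ t → inner s t ≟ᵇ inner t s) k) k
    ×-dec allUpTo? (λ t → inner t t ≟ᵇ false) k
    ×-dec allUpTo? (λ t → bit (to₀ t) + bit (to₁ t) + count k (inner t) ≟ 3) k)

-- New vertices 0 … size - 1, to be glued to the old vertices 0 and 1 along to₀ and to₁.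
record Gadget : Set where
  field
    size    : ℕ
    inner   : ℕ → ℕ → Bool
    to₀ to₁ : ℕ → Bool
    isCubic : IsCubic size inner to₀ to₁

  gain₀ gain₁ : ℕ
  gain₀ = count size to₀
  gain₁ = count size to₁

  link : ℕ → ℕ → Bool
  link 0             t = to₀ t
  link 1             t = to₁ t
  link (suc (suc _)) t = false

open Gadget

glue : ℕ → (ℕ → ℕ → Bool) → Gadget → ℕ → ℕ → Bool
glue n edge g i j =
  if i <ᵇ n then (if j <ᵇ n then edge i j else link g i (j ∸ n))
            else (if j <ᵇ n then link g j (i ∸ n) else inner g (i ∸ n) (j ∸ n))

data Side (n k : ℕ) : ℕ → Set where
  old : ∀ {i} → i < n → Side n k i
  new : ∀ {t} → t < k → Side n k (n + t)

side : ∀ n k {i} → i < n + k → Side n k i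
side n k {i} i<n+k with i <? n
... | yes i<n = old i<n
... | no  i≮n = subst (Side n k) (m+[n∸m]≡n (≮⇒≥ i≮n))
                  (new (+-cancelˡ-< n (i ∸ n) k (subst (_< n + k) (≡.sym (m+[n∸m]≡n (≮⇒≥ i≮n))) i<n+k)))

module _ (n : ℕ) (edge : ℕ → ℕ → Bool) (g : Gadget) where

  private
    <ᵇ-old : ∀ {i} → i < n → (i <ᵇ n) ≡ true
    <ᵇ-old i<n = Equivalence.to T-≡ (<⇒<ᵇ i<n)
    <ᵇ-new : ∀ m t → (m + t <ᵇ m) ≡ false
    <ᵇ-new zero    t = refl
    <ᵇ-new (suc m) t = <ᵇ-new m t

  glue-old-old : ∀ {i j} → i < n → j < n → glue n edge g i j ≡ edge i j
  glue-old-old i<n j<n rewrite <ᵇ-old i<n | <ᵇ-old j<n = refl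

  glue-old-new : ∀ {i} t → i < n → glue n edge g i (n + t) ≡ link g i t
  glue-old-new t i<n rewrite <ᵇ-old i<n | <ᵇ-new n t | m+n∸m≡n n t = refl

  glue-new-old : ∀ {j} t → j < n → glue n edge g (n + t) j ≡ link g j t
  glue-new-old t j<n rewrite <ᵇ-old j<n | <ᵇ-new n t | m+n∸m≡n n t = refl

  glue-new-new : ∀ s t → glue n edge g (n + s) (n + t) ≡ inner g s t
  glue-new-new s t rewrite <ᵇ-new n s | <ᵇ-new n t | m+n∸m≡n n s | m+n∸m≡n n t = refl

count-link : ∀ m (g : Gadget) t → count (2 + m) (λ j → link g j t) ≡ bit (to₀ g t) + bit (to₁ g t)
count-link m g t = begin
  bit (to₀ g t) + (bit (to₁ g t) + count m (const false)) ≡⟨ cong (λ c → bit (to₀ g t) + (bit (to₁ g t) + c)) (count-false m) ⟩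
  bit (to₀ g t) + (bit (to₁ g t) + 0)                     ≡⟨ cong (bit (to₀ g t) +_) (+-identityʳ _) ⟩
  bit (to₀ g t) + bit (to₁ g t)                           ∎
  where open ≡-Reasoning

profile-gain : ∀ d₁ d₂ (g : Gadget) i → profile d₁ d₂ i + count (size g) (link g i) ≡ profile (d₁ + gain₀ g) (d₂ + gain₁ g) i
profile-gain d₁ d₂ g 0             = refl
profile-gain d₁ d₂ g 1             = refl
profile-gain d₁ d₂ g (suc (suc _)) = cong (3 +_) (count-false (size g))

attach : ∀ {k} {H : Graph k} {n d₁ d₂} (g : Gadget) → 2 ≤ n → Realization H n d₁ d₂
       → Realization H (size g + n) (gain₀ g + d₁) (gain₁ g + d₂)
attach {H = H} {n@(suc (suc m))} {d₁} {d₂} g (s≤s (s≤s z≤n)) r =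
  subst₃ (Realization H) (+-comm n k) (+-comm d₁ (gain₀ g)) (+-comm d₂ (gain₁ g)) (record
    { edge          = glue n edge g
    ; isRealization = mkIsRealization glue-sym glue-irrefl glue-degree
    ; embed         = embed
    ; isEmbedding   = mkIsEmbedding (λ u → m≤n⇒m≤n+o k (bounded u)) injective
                        (λ u v e → trans (glue-old-old n edge g (bounded u) (bounded v)) (preserves u v e))
    })
  where
  open Realization r
  open IsCubic (isCubic g)
  k = size g
  subst₃ : ∀ (P : ℕ → ℕ → ℕ → Set) {a a′ b b′ c c′} → a ≡ a′ → b ≡ b′ → c ≡ c′ → P a b c → P a′ b′ c′
  subst₃ P refl refl refl p = p

  glue-sym : ∀ {i} → i < n + k → ∀ {j} → j < n + k → glue n edge g i j ≡ glue n edge g j i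
  glue-sym i< j< with side n k i< | side n k j<
  ... | old i<n | old j<n = trans (glue-old-old n edge g i<n j<n)
                              (trans (edge-sym i<n j<n) (≡.sym (glue-old-old n edge g j<n i<n)))
  ... | old i<n | new {s} _ = trans (glue-old-new n edge g s i<n) (≡.sym (glue-new-old n edge g s i<n))
  ... | new {t} _ | old j<n = trans (glue-new-old n edge g t j<n) (≡.sym (glue-old-new n edge g t j<n))
  ... | new {t} t<k | new {s} s<k = trans (glue-new-new n edge g t s)
                                      (trans (inner-sym t<k s<k) (≡.sym (glue-new-new n edge g s t)))

  glue-irrefl : ∀ {i} → i < n + k → glue n edge g i i ≡ false
  glue-irrefl i< with side n k i<
  ... | old i<n     = trans (glue-old-old n edge g i<n i<n) (edge-irrefl i<n)
  ... | new {t} t<k = trans (glue-new-new n edge g t t) (inner-irrefl t<k)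

  glue-degree : ∀ {i} → i < n + k → count (n + k) (glue n edge g i) ≡ profile (d₁ + gain₀ g) (d₂ + gain₁ g) i
  glue-degree {i} i< with side n k i<
  ... | old i<n = begin
    count (n + k) (glue n edge g i)                                            ≡⟨ count-+ n k (glue n edge g i) ⟩
    count n (glue n edge g i) + count k (λ t → glue n edge g i (n + t))        ≡⟨ cong₂ _+_
         (count-cong n (glue-old-old n edge g i<n)) (count-cong k (λ {t} _ → glue-old-new n edge g t i<n)) ⟩
    count n (edge i) + count k (link g i)                                      ≡⟨ cong (_+ count k (link g i)) (degree i<n) ⟩
    profile d₁ d₂ i + count k (link g i)                                       ≡⟨ profile-gain d₁ d₂ g i ⟩
    profile (d₁ + gain₀ g) (d₂ + gain₁ g) i                                    ∎
    where open ≡-Reasoning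
  ... | new {t} t<k = begin
    count (n + k) (glue n edge g (n + t))                                      ≡⟨ count-+ n k (glue n edge g (n + t)) ⟩
    count n (glue n edge g (n + t)) + count k (λ s → glue n edge g (n + t) (n + s)) ≡⟨ cong₂ _+_
         (count-cong n (glue-new-old n edge g t)) (count-cong k (λ {s} _ → glue-new-new n edge g t s)) ⟩
    count n (λ j → link g j t) + count k (inner g t)                           ≡⟨ cong (_+ count k (inner g t)) (count-link m g t) ⟩
    bit (to₀ g t) + bit (to₁ g t) + count k (inner g t)                        ≡⟨ cubic t<k ⟩
    3                                                                          ∎
    where open ≡-Reasoning

grow : ℕ × ℕ × ℕ → List Gadget → ℕ × ℕ × ℕ
grow s             []       = s
grow (n , d₁ , d₂) (g ∷ gs) = grow (size g + n , gain₀ g + d₁ , gain₁ g + d₂) gs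

RealizationAt : ∀ {k} → Graph k → ℕ × ℕ × ℕ → Set
RealizationAt H (n , d₁ , d₂) = Realization H n d₁ d₂

attachAll : ∀ {k} {H : Graph k} {n d₁ d₂} → 2 ≤ n → Realization H n d₁ d₂
          → (gs : List Gadget) → RealizationAt H (grow (n , d₁ , d₂) gs)
attachAll         2≤n r []       = r
attachAll {n = n} 2≤n r (g ∷ gs) = attachAll (≤-trans 2≤n (m≤n+m n (size g))) (attach g 2≤n r) gs

infix 4 _⊕_

data Recipe {k} (H : Graph k) : Set where
  _⊕_ : ∀ {m d₁ d₂} → Realization H (2 + m) d₁ d₂ → List Gadget → Recipe H

shape : ∀ {k} {H : Graph k} → Recipe H → ℕ × ℕ × ℕ
shape (_⊕_ {m} {d₁} {d₂} _ gs) = grow (2 + m , d₁ , d₂) gs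

cook : ∀ {k} {H : Graph k} (ρ : Recipe H) → RealizationAt H (shape ρ)
cook (seed ⊕ gs) = attachAll (s≤s (s≤s z≤n)) seed gs

_≟₃_ : (s t : ℕ × ℕ × ℕ) → Dec (s ≡ t)
_≟₃_ = ≡-dec _≟_ (≡-dec _≟_ _≟_)

module _ {k} {H : Graph k} {P : ℕ → ℕ → ℕ → Set} (recipe : ℕ → ℕ → ℕ → Recipe H) where

  Covers : ℕ → Set
  Covers b = ∀ {n} → n < b → ∀ {d₁} → d₁ < b → ∀ {d₂} → d₂ < b → P n d₁ d₂ → shape (recipe n d₁ d₂) ≡ (n , d₁ , d₂)

  covers? : (∀ n d₁ d₂ → Dec (P n d₁ d₂)) → ∀ b → Dec (Covers b)
  covers? P? b = allUpTo? (λ n → allUpTo? (λ d₁ → allUpTo? (λ d₂ →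
                   P? n d₁ d₂ →-dec shape (recipe n d₁ d₂) ≟₃ (n , d₁ , d₂)) b) b) b

  realize-covered : ∀ {b} → Covers b → ∀ {n d₁ d₂} → n < b → d₁ < b → d₂ < b → P n d₁ d₂ → Realization H n d₁ d₂
  realize-covered cov {n} {d₁} {d₂} n<b d₁<b d₂<b p =
    subst (RealizationAt H) (cov n<b d₁<b d₂<b p) (cook (recipe n d₁ d₂))

edges : List (ℕ × ℕ) → ℕ → ℕ → Bool
edges es i j = any (λ { (a , b) → ((a ≡ᵇ i) ∧ (b ≡ᵇ j)) ∨ ((a ≡ᵇ j) ∧ (b ≡ᵇ i)) }) es

members : List ℕ → ℕ → Bool
members xs t = any (_≡ᵇ t) xs

mkGadget : ∀ k es xs ys → {True (isCubic? k (edges es) (members xs) (members ys))} → Gadget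
mkGadget k es xs ys {c} = record
  { size = k ; inner = edges es ; to₀ = members xs ; to₁ = members ys ; isCubic = toWitness c }

mkRealization : ∀ {k} (H : Graph k) n d₁ d₂ (edge : ℕ → ℕ → Bool) (f : Fin k → ℕ)
              → {True (isRealization? n d₁ d₂ edge ×-dec isEmbedding? H n edge f)} → Realization H n d₁ d₂
mkRealization H n d₁ d₂ edge f {valid} = record
  { edge = edge ; isRealization = proj₁ (toWitness valid) ; embed = f ; isEmbedding = proj₂ (toWitness valid) }

record Admissible (n d₁ d₂ : ℕ) : Set where
  constructor mkAdmissible
  field
    n≥6    : 6 ≤ n
    d₁≤n∸1 : d₁ ≤ n ∸ 1
    d₂≤d₁  : d₂ ≤ d₁
    d₂≥3   : 3 ≤ d₂
    d₁≥5   : 5 ≤ d₁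
    σ-even : 2 ∣ σπ n d₁ d₂

admissible? : ∀ n d₁ d₂ → Dec (Admissible n d₁ d₂)
admissible? n d₁ d₂ =
  map′ (λ { (a , b , c , d , e , f) → mkAdmissible a b c d e f })
       (λ { (mkAdmissible a b c d e f) → a , b , c , d , e , f })
    (6 ≤? n ×-dec d₁ ≤? n ∸ 1 ×-dec d₂ ≤? d₁ ×-dec 3 ≤? d₂ ×-dec 5 ≤? d₁ ×-dec 2 ∣? σπ n d₁ d₂)

admissible-bounded : ∀ {n d₁ d₂} → n ≤ 13 → Admissible n d₁ d₂ → d₁ < 14 × d₂ < 14
admissible-bounded {n} n≤13 adm = s≤s d₁≤13 , s≤s (≤-trans (Admissible.d₂≤d₁ adm) d₁≤13)
  where
  d₁≤13 = ≤-trans (Admissible.d₁≤n∸1 adm) (≤-trans (m∸n≤m n 1) n≤13)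

record Unexceptional (n d₁ d₂ : ℕ) : Set where
  constructor mkUnexceptional
  field
    even-case : 7 ≤ n → 2 ∣ n → ¬ (d₁ ≡ n ∸ 1 × d₂ ≡ n ∸ 1) × ¬ (d₁ ≡ n ∸ 2 × d₂ ≡ n ∸ 2)
    odd-case  : 7 ≤ n → ¬ (2 ∣ n) → ¬ (d₁ ≡ n ∸ 1 × d₂ ≡ n ∸ 2)
    unlisted  : ¬ ((n , d₁ , d₂) ∈ exceptions)

unexceptional? : ∀ n d₁ d₂ → Dec (Unexceptional n d₁ d₂)
unexceptional? n d₁ d₂ =
  map′ (λ { (a , b , c) → mkUnexceptional a b c }) (λ { (mkUnexceptional a b c) → a , b , c })
    (  (7 ≤? n →-dec 2 ∣? n →-dec ¬? (d₁ ≟ n ∸ 1 ×-dec d₂ ≟ n ∸ 1) ×-dec ¬? (d₁ ≟ n ∸ 2 ×-dec d₂ ≟ n ∸ 2))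
    ×-dec (7 ≤? n →-dec ¬? (2 ∣? n) →-dec ¬? (d₁ ≟ n ∸ 1 ×-dec d₂ ≟ n ∸ 2))
    ×-dec ¬? ((n , d₁ , d₂) ∈? exceptions))
  where open import Data.List.Membership.DecPropositional _≟₃_ using (_∈?_)

exceptions-n≤9 : All (λ e → proj₁ e ≤ 9) exceptions
exceptions-n≤9 = toWitness {a? = All.all? (λ e → proj₁ e ≤? 9) exceptions} _

3+d≤n⇒d≢n∸k : ∀ {n d} k → k ≤ 2 → 3 + d ≤ n → d ≢ n ∸ k
3+d≤n⇒d≢n∸k {n} {d} k k≤2 3+d≤n refl = <-irrefl refl (begin-strict
  n           ≡⟨ m∸n+n≡m k≤n ⟨
  n ∸ k + k   ≤⟨ +-monoʳ-≤ (n ∸ k) k≤2 ⟩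
  n ∸ k + 2   <⟨ +-monoʳ-< (n ∸ k) (n<1+n 2) ⟩
  n ∸ k + 3   ≡⟨ +-comm (n ∸ k) 3 ⟩
  3 + (n ∸ k) ≤⟨ 3+d≤n ⟩
  n           ∎)
  where
  open ≤-Reasoning
  k≤n = ≤-trans k≤2 (≤-trans (n≤1+n 2) (≤-trans (m≤m+n 3 d) 3+d≤n))

10≤n⇒unlisted : ∀ {n d₁ d₂} → 10 ≤ n → ¬ ((n , d₁ , d₂) ∈ exceptions)
10≤n⇒unlisted 10≤n e = ≤⇒≯ (All.lookup exceptions-n≤9 e) 10≤n

unexceptional-small-d₂ : ∀ {m d₁ d₂} → 3 + d₂ ≤ 10 + m → Unexceptional (10 + m) d₁ d₂
unexceptional-small-d₂ {m} 3+d₂≤n = mkUnexceptional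
  (λ _ _ → (3+d≤n⇒d≢n∸k 1 (s≤s z≤n) 3+d₂≤n ∘ proj₂) , (3+d≤n⇒d≢n∸k 2 ≤-refl 3+d₂≤n ∘ proj₂))
  (λ _ _ → 3+d≤n⇒d≢n∸k 2 ≤-refl 3+d₂≤n ∘ proj₂)
  (10≤n⇒unlisted (m≤m+n 10 m))

unexceptional-drop-g222 : ∀ {m a b} → Unexceptional (14 + m) (2 + a) (2 + b) → Unexceptional (12 + m) a b
unexceptional-drop-g222 {m} {a} {b} u = mkUnexceptional
  (λ _ 2∣n → let ¬top , ¬next = even-case 7≤14+m (∣m∣n⇒∣m+n ∣-refl 2∣n) in ¬top ∘ shift , ¬next ∘ shift)
  (λ _ 2∤n → odd-case 7≤14+m (2∤n ∘ λ 2∣2+n → ∣m+n∣m⇒∣n 2∣2+n ∣-refl) ∘ shift)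
  (10≤n⇒unlisted (m≤m+n 10 (2 + m)))
  where
  open Unexceptional u
  7≤14+m = m≤m+n 7 (7 + m)
  shift : ∀ {x y} → a ≡ x × b ≡ y → 2 + a ≡ 2 + x × 2 + b ≡ 2 + y
  shift (a≡x , b≡y) = cong (2 +_) a≡x , cong (2 +_) b≡y

2∣2k+x⇒2∣x : ∀ k {x} → 2 ∣ 2 * k + x → 2 ∣ x
2∣2k+x⇒2∣x k 2∣2k+x = ∣m+n∣m⇒∣n 2∣2k+x (divides k (*-comm 2 k))

admissible-drop-K₄ : ∀ {m d₁ d₂} → Admissible (14 + m) d₁ d₂ → d₁ ≤ 9 + m → Admissible (10 + m) d₁ d₂
admissible-drop-K₄ {m} {d₁} {d₂} (mkAdmissible _ _ d₂≤d₁ d₂≥3 d₁≥5 even) d₁≤9+m =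
  mkAdmissible (m≤m+n 6 (4 + m)) d₁≤9+m d₂≤d₁ d₂≥3 d₁≥5 (2∣2k+x⇒2∣x 6 (subst (2 ∣_) (σ-shift d₁ d₂ m) even))
  where
  σ-shift : ∀ d₁ d₂ m → d₁ + d₂ + 3 * (12 + m) ≡ 2 * 6 + (d₁ + d₂ + 3 * (8 + m))
  σ-shift = solve-∀

admissible-drop-g222 : ∀ {m a b} → Admissible (14 + m) (2 + a) (2 + b) → 3 ≤ b → 5 ≤ a → Admissible (12 + m) a b
admissible-drop-g222 {m} {a} {b} (mkAdmissible _ (s≤s (s≤s a≤)) (s≤s (s≤s b≤a)) _ _ even) b≥3 a≥5 =
  mkAdmissible (m≤m+n 6 (6 + m)) a≤ b≤a b≥3 a≥5 (2∣2k+x⇒2∣x 5 (subst (2 ∣_) (σ-shift a b m) even))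
  where
  σ-shift : ∀ a b m → 2 + a + (2 + b) + 3 * (12 + m) ≡ 2 * 5 + (a + b + 3 * (10 + m))
  σ-shift = solve-∀

admissible-drop-g330 : ∀ {m a b} → Admissible (14 + m) (3 + a) b → b ≤ 4 → 5 ≤ a → Admissible (11 + m) a b
admissible-drop-g330 {m} {a} {b} (mkAdmissible _ (s≤s (s≤s (s≤s a≤))) _ b≥3 _ even) b≤4 a≥5 =
  mkAdmissible (m≤m+n 6 (5 + m)) a≤ (≤-trans b≤4 (≤-trans (n≤1+n 4) a≥5)) b≥3 a≥5
    (2∣2k+x⇒2∣x 6 (subst (2 ∣_) (σ-shift a b m) even))
  where
  σ-shift : ∀ a b m → 3 + a + b + 3 * (12 + m) ≡ 2 * 6 + (a + b + 3 * (9 + m))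
  σ-shift = solve-∀

record Hereditary (Q : ℕ → ℕ → ℕ → Set) : Set where
  field
    drop-K₄   : ∀ {m d₁ d₂} → Q (14 + m) d₁ d₂ → d₂ ≤ 7 + m → Q (10 + m) d₁ d₂
    drop-g222 : ∀ {m a b} → Q (14 + m) (2 + a) (2 + b) → Q (12 + m) a b
    drop-g330 : ∀ {m a b} → Q (14 + m) (3 + a) b → b ≤ 4 → Q (11 + m) a b

-- Reduction to n ≤ 13

-- gₖₐᵦ has k vertices, a of them joined to vertex 0 and b to vertex 1.
g400 : Gadget
g400 = mkGadget 4 ((0 , 1) ∷ (0 , 2) ∷ (0 , 3) ∷ (1 , 2) ∷ (1 , 3) ∷ (2 , 3) ∷ []) [] []

g222 : Gadget
g222 = mkGadget 2 ((0 , 1) ∷ []) (0 ∷ 1 ∷ []) (0 ∷ 1 ∷ [])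

g330 : Gadget
g330 = mkGadget 3 ((0 , 1) ∷ (0 , 2) ∷ (1 , 2) ∷ []) (0 ∷ 1 ∷ 2 ∷ []) []

module _ {k} {H : Graph k} {Q : ℕ → ℕ → ℕ → Set} (Q-hereditary : Hereditary Q)
         (small : ∀ {n d₁ d₂} → n ≤ 13 → Admissible n d₁ d₂ → Q n d₁ d₂ → Realization H n d₁ d₂) where

  open Hereditary Q-hereditary

  private
    Goal : ℕ → Set
    Goal n = ∀ {d₁ d₂} → Admissible n d₁ d₂ → Q n d₁ d₂ → Realization H n d₁ d₂

    Below : ℕ → Set
    Below n = ∀ {n′} → n′ < n → Goal n′

    via-K₄ : ∀ m {d₁ d₂} → Below (14 + m) → d₁ ≤ 7 + m
           → Admissible (14 + m) d₁ d₂ → Q (14 + m) d₁ d₂ → Realization H (14 + m) d₁ d₂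
    via-K₄ m rec d₁≤7+m adm q =
      attach g400 (m≤m+n 2 (8 + m)) (rec (m<n+m (10 + m) {4} z<s)
        (admissible-drop-K₄ adm (≤-trans d₁≤7+m (m≤n+m (7 + m) 2)))
        (drop-K₄ q (≤-trans (Admissible.d₂≤d₁ adm) d₁≤7+m)))

    via-g222 : ∀ m {d₁ d₂} → Below (14 + m) → 8 + m ≤ d₁ → 5 ≤ d₂
             → Admissible (14 + m) d₁ d₂ → Q (14 + m) d₁ d₂ → Realization H (14 + m) d₁ d₂
    via-g222 m {suc (suc a)} {suc (suc b)} rec (s≤s (s≤s a≥6+m)) (s≤s (s≤s b≥3)) adm q =
      attach g222 (m≤m+n 2 (10 + m)) (rec (m<n+m (12 + m) {2} z<s)
        (admissible-drop-g222 adm b≥3 (≤-trans (m≤m+n 5 (1 + m)) a≥6+m))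
        (drop-g222 q))

    via-g330 : ∀ m {d₁ d₂} → Below (14 + m) → 8 + m ≤ d₁ → d₂ ≤ 4
             → Admissible (14 + m) d₁ d₂ → Q (14 + m) d₁ d₂ → Realization H (14 + m) d₁ d₂
    via-g330 m {suc (suc (suc a))} rec (s≤s (s≤s (s≤s a≥5+m))) d₂≤4 adm q =
      attach g330 (m≤m+n 2 (9 + m)) (rec (m<n+m (11 + m) {3} z<s)
        (admissible-drop-g330 adm d₂≤4 (≤-trans (m≤m+n 5 m) a≥5+m))
        (drop-g330 q d₂≤4))

    large : ∀ m → Below (14 + m) → Goal (14 + m)
    large m rec {d₁} {d₂} adm q with d₁ ≤? 7 + m | 5 ≤? d₂
    ... | yes d₁≤7+m | _        = via-K₄ m rec d₁≤7+m adm q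
    ... | no  d₁≰7+m | yes d₂≥5 = via-g222 m rec (≰⇒> d₁≰7+m) d₂≥5 adm q
    ... | no  d₁≰7+m | no  d₂≱5 = via-g330 m rec (≰⇒> d₁≰7+m) (≤-pred (≰⇒> d₂≱5)) adm q

    beyond-13 : ∀ {n} → ∃ (λ m → 14 + m ≡ n) → Below n → Goal n
    beyond-13 (m , refl) = large m

  realize : ∀ n {d₁ d₂} → Admissible n d₁ d₂ → Q n d₁ d₂ → Realization H n d₁ d₂
  realize = <-rec Goal λ n rec adm q → case n ≤? 13 of λ where
    (yes n≤13) → small n≤13 adm q
    (no  n≰13) → beyond-13 (m≤n⇒∃[o]m+o≡n (≰⇒> n≰13)) rec adm q

unexceptional-hereditary : Hereditary Unexceptional
unexceptional-hereditary = record
  { drop-K₄   = λ _ d₂≤7+m → unexceptional-small-d₂ (+-monoʳ-≤ 3 d₂≤7+m)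
  ; drop-g222 = unexceptional-drop-g222
  ; drop-g330 = λ {m} _ b≤4 → unexceptional-small-d₂ (≤-trans (+-monoʳ-≤ 3 b≤4) (m≤m+n 7 (4 + m)))
  }

trivial-hereditary : Hereditary (λ _ _ _ → ⊤)
trivial-hereditary = record { drop-K₄ = λ _ _ → tt ; drop-g222 = λ _ → tt ; drop-g330 = λ _ _ → tt }

-- Realizations for n ≤ 13

-- K₆ − C₅ is the wheel with hub 5 and rim 0-2-4-1-3-0 (the complement of the removed cycle).
W₅-skipping-1 : List (ℕ × ℕ)
W₅-skipping-1 = (2 , 3) ∷ (3 , 4) ∷ (4 , 5) ∷ (5 , 6) ∷ (6 , 2) ∷ (0 , 2) ∷ (0 , 3) ∷ (0 , 4) ∷ (0 , 5) ∷ (0 , 6) ∷ []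

W₅+K₁ : Realization K6-C5 7 5 0
W₅+K₁ = mkRealization K6-C5 7 5 0 (edges W₅-skipping-1) (lookup (2 ∷ᵥ 5 ∷ᵥ 3 ∷ᵥ 6 ∷ᵥ 4 ∷ᵥ 0 ∷ᵥ []ᵥ))

W₅+pendant : Realization K6-C5 7 6 1
W₅+pendant = mkRealization K6-C5 7 6 1 (edges ((0 , 1) ∷ W₅-skipping-1)) (lookup (2 ∷ᵥ 5 ∷ᵥ 3 ∷ᵥ 6 ∷ᵥ 4 ∷ᵥ 0 ∷ᵥ []ᵥ))

W₅ : Realization K6-C5 6 5 3
W₅ = mkRealization K6-C5 6 5 3
  (edges ((1 , 2) ∷ (2 , 3) ∷ (3 , 4) ∷ (4 , 5) ∷ (5 , 1) ∷ (0 , 1) ∷ (0 , 2) ∷ (0 , 3) ∷ (0 , 4) ∷ (0 , 5) ∷ []))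
  (lookup (1 ∷ᵥ 4 ∷ᵥ 2 ∷ᵥ 5 ∷ᵥ 3 ∷ᵥ 0 ∷ᵥ []ᵥ))

W₅′ : Realization K6-C5 6 3 5
W₅′ = mkRealization K6-C5 6 3 5
  (edges ((0 , 2) ∷ (2 , 3) ∷ (3 , 4) ∷ (4 , 5) ∷ (5 , 0) ∷ (1 , 0) ∷ (1 , 2) ∷ (1 , 3) ∷ (1 , 4) ∷ (1 , 5) ∷ []))
  (lookup (0 ∷ᵥ 4 ∷ᵥ 2 ∷ᵥ 5 ∷ᵥ 3 ∷ᵥ 1 ∷ᵥ []ᵥ))

K₂ : Realization (edgeless 0) 2 1 1
K₂ = mkRealization (edgeless 0) 2 1 1 (edges ((0 , 1) ∷ [])) (λ ())

K̄₂ : Realization (edgeless 0) 2 0 0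
K̄₂ = mkRealization (edgeless 0) 2 0 0 (edges []) (λ ())

g321 : Gadget
g321 = mkGadget 3 ((0 , 1) ∷ (0 , 2) ∷ (1 , 2) ∷ []) (0 ∷ 1 ∷ []) (2 ∷ [])

g332 : Gadget
g332 = mkGadget 3 ((0 , 1) ∷ (0 , 2) ∷ []) (1 ∷ 2 ∷ 0 ∷ []) (1 ∷ 2 ∷ [])

g604 : Gadget
g604 = mkGadget 6 ((0 , 3) ∷ (0 , 4) ∷ (0 , 5) ∷ (1 , 2) ∷ (1 , 4) ∷ (1 , 5) ∷ (2 , 3) ∷ []) [] (2 ∷ 3 ∷ 4 ∷ 5 ∷ [])

g433 : Gadget
g433 = mkGadget 4 ((0 , 1) ∷ (0 , 2) ∷ (0 , 3) ∷ []) (1 ∷ 2 ∷ 3 ∷ []) (1 ∷ 2 ∷ 3 ∷ [])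

g613 : Gadget
g613 = mkGadget 6 ((0 , 2) ∷ (0 , 4) ∷ (0 , 5) ∷ (1 , 2) ∷ (1 , 3) ∷ (1 , 4) ∷ (2 , 3) ∷ []) (5 ∷ []) (5 ∷ 3 ∷ 4 ∷ [])

g303 : Gadget
g303 = mkGadget 3 ((0 , 1) ∷ (0 , 2) ∷ (1 , 2) ∷ []) [] (0 ∷ 1 ∷ 2 ∷ [])

g442 : Gadget
g442 = mkGadget 4 ((0 , 1) ∷ (0 , 3) ∷ (1 , 2) ∷ []) (2 ∷ 3 ∷ 0 ∷ 1 ∷ []) (2 ∷ 3 ∷ [])

g424 : Gadget
g424 = mkGadget 4 ((0 , 1) ∷ (0 , 3) ∷ (1 , 2) ∷ []) (2 ∷ 3 ∷ []) (2 ∷ 3 ∷ 0 ∷ 1 ∷ [])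

g431 : Gadget
g431 = mkGadget 4 ((0 , 1) ∷ (0 , 2) ∷ (0 , 3) ∷ (1 , 2) ∷ []) (3 ∷ 1 ∷ 2 ∷ []) (3 ∷ [])

g402 : Gadget
g402 = mkGadget 4 ((0 , 1) ∷ (0 , 2) ∷ (0 , 3) ∷ (1 , 2) ∷ (1 , 3) ∷ []) [] (2 ∷ 3 ∷ [])

g404 : Gadget
g404 = mkGadget 4 ((0 , 2) ∷ (0 , 3) ∷ (1 , 2) ∷ (1 , 3) ∷ []) [] (0 ∷ 1 ∷ 2 ∷ 3 ∷ [])

g440 : Gadget
g440 = mkGadget 4 ((0 , 2) ∷ (0 , 3) ∷ (1 , 2) ∷ (1 , 3) ∷ []) (0 ∷ 1 ∷ 2 ∷ 3 ∷ []) []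

g523 : Gadget
g523 = mkGadget 5 ((0 , 1) ∷ (0 , 2) ∷ (0 , 4) ∷ (1 , 2) ∷ (1 , 3) ∷ []) (3 ∷ 4 ∷ []) (3 ∷ 4 ∷ 2 ∷ [])

g503 : Gadget
g503 = mkGadget 5 ((0 , 2) ∷ (0 , 3) ∷ (0 , 4) ∷ (1 , 2) ∷ (1 , 3) ∷ (1 , 4) ∷ []) [] (2 ∷ 3 ∷ 4 ∷ [])

g323 : Gadget
g323 = mkGadget 3 ((0 , 1) ∷ (0 , 2) ∷ []) (1 ∷ 2 ∷ []) (1 ∷ 2 ∷ 0 ∷ [])

g602 : Gadget
g602 = mkGadget 6 ((0 , 3) ∷ (0 , 4) ∷ (0 , 5) ∷ (1 , 2) ∷ (1 , 3) ∷ (1 , 5) ∷ (2 , 3) ∷ (2 , 4) ∷ []) [] (4 ∷ 5 ∷ [])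

-- Only the entries for the triples checked by Covers matter; the final catch-all is arbitrary.
recipeK₆-C₅ : ℕ → ℕ → ℕ → Recipe K6-C5
recipeK₆-C₅ 6 5 3 = W₅ ⊕ []
recipeK₆-C₅ 8 7 5 = W₅ ⊕ g222 ∷ []
recipeK₆-C₅ 9 6 5 = W₅′ ⊕ g330 ∷ []
recipeK₆-C₅ 9 7 4 = W₅ ⊕ g321 ∷ []
recipeK₆-C₅ 9 7 6 = W₅ ⊕ g323 ∷ []
recipeK₆-C₅ 9 8 3 = W₅+pendant ⊕ g222 ∷ []
recipeK₆-C₅ 9 8 5 = W₅ ⊕ g332 ∷ []
recipeK₆-C₅ 10 5 3 = W₅+K₁ ⊕ g303 ∷ []
recipeK₆-C₅ 10 5 5 = W₅ ⊕ g402 ∷ []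
recipeK₆-C₅ 10 6 4 = W₅+pendant ⊕ g303 ∷ []
recipeK₆-C₅ 10 6 6 = W₅′ ⊕ g431 ∷ []
recipeK₆-C₅ 10 7 3 = W₅+K₁ ⊕ g323 ∷ []
recipeK₆-C₅ 10 7 5 = W₅′ ⊕ g440 ∷ []
recipeK₆-C₅ 10 7 7 = W₅ ⊕ g424 ∷ []
recipeK₆-C₅ 10 8 4 = W₅+pendant ⊕ g323 ∷ []
recipeK₆-C₅ 10 8 6 = W₅ ⊕ g433 ∷ []
recipeK₆-C₅ 10 9 3 = W₅+pendant ⊕ g332 ∷ []
recipeK₆-C₅ 10 9 5 = W₅ ⊕ g442 ∷ []
recipeK₆-C₅ 10 9 7 = W₅ ⊕ g222 ∷ g222 ∷ []
recipeK₆-C₅ 11 5 4 = W₅+K₁ ⊕ g404 ∷ []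
recipeK₆-C₅ 11 6 3 = W₅+pendant ⊕ g402 ∷ []
recipeK₆-C₅ 11 6 5 = W₅+pendant ⊕ g404 ∷ []
recipeK₆-C₅ 11 7 4 = W₅+K₁ ⊕ g424 ∷ []
recipeK₆-C₅ 11 7 6 = W₅ ⊕ g523 ∷ []
recipeK₆-C₅ 11 8 3 = W₅+K₁ ⊕ g433 ∷ []
recipeK₆-C₅ 11 8 5 = W₅+pendant ⊕ g424 ∷ []
recipeK₆-C₅ 11 8 7 = W₅′ ⊕ g222 ∷ g330 ∷ []
recipeK₆-C₅ 11 9 4 = W₅+pendant ⊕ g433 ∷ []
recipeK₆-C₅ 11 9 6 = W₅ ⊕ g222 ∷ g321 ∷ []
recipeK₆-C₅ 11 9 8 = W₅ ⊕ g222 ∷ g323 ∷ []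
recipeK₆-C₅ 11 10 3 = W₅+pendant ⊕ g442 ∷ []
recipeK₆-C₅ 11 10 5 = W₅+pendant ⊕ g222 ∷ g222 ∷ []
recipeK₆-C₅ 11 10 7 = W₅ ⊕ g222 ∷ g332 ∷ []
recipeK₆-C₅ 12 5 3 = W₅+K₁ ⊕ g503 ∷ []
recipeK₆-C₅ 12 5 5 = W₅ ⊕ g602 ∷ []
recipeK₆-C₅ 12 6 4 = W₅+pendant ⊕ g503 ∷ []
recipeK₆-C₅ 12 6 6 = W₅ ⊕ g613 ∷ []
recipeK₆-C₅ 12 7 3 = W₅+K₁ ⊕ g523 ∷ []
recipeK₆-C₅ 12 7 5 = W₅+K₁ ⊕ g222 ∷ g303 ∷ []
recipeK₆-C₅ 12 7 7 = W₅ ⊕ g222 ∷ g402 ∷ []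
recipeK₆-C₅ 12 8 4 = W₅+pendant ⊕ g523 ∷ []
recipeK₆-C₅ 12 8 6 = W₅+pendant ⊕ g222 ∷ g303 ∷ []
recipeK₆-C₅ 12 8 8 = W₅ ⊕ g332 ∷ g303 ∷ []
recipeK₆-C₅ 12 9 3 = W₅+K₁ ⊕ g222 ∷ g321 ∷ []
recipeK₆-C₅ 12 9 5 = W₅+K₁ ⊕ g222 ∷ g323 ∷ []
recipeK₆-C₅ 12 9 7 = W₅ ⊕ g321 ∷ g323 ∷ []
recipeK₆-C₅ 12 9 9 = W₅ ⊕ g222 ∷ g424 ∷ []
recipeK₆-C₅ 12 10 4 = W₅+K₁ ⊕ g222 ∷ g332 ∷ []
recipeK₆-C₅ 12 10 6 = W₅+pendant ⊕ g222 ∷ g323 ∷ []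
recipeK₆-C₅ 12 10 8 = W₅ ⊕ g222 ∷ g433 ∷ []
recipeK₆-C₅ 12 11 3 = W₅+pendant ⊕ g222 ∷ g330 ∷ []
recipeK₆-C₅ 12 11 5 = W₅+pendant ⊕ g222 ∷ g332 ∷ []
recipeK₆-C₅ 12 11 7 = W₅ ⊕ g222 ∷ g442 ∷ []
recipeK₆-C₅ 12 11 9 = W₅ ⊕ g222 ∷ g222 ∷ g222 ∷ []
recipeK₆-C₅ 13 5 4 = W₅+K₁ ⊕ g604 ∷ []
recipeK₆-C₅ 13 6 3 = W₅+K₁ ⊕ g613 ∷ []
recipeK₆-C₅ 13 6 5 = W₅+pendant ⊕ g604 ∷ []
recipeK₆-C₅ 13 7 4 = W₅+pendant ⊕ g613 ∷ []
recipeK₆-C₅ 13 7 6 = W₅+K₁ ⊕ g222 ∷ g404 ∷ []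
recipeK₆-C₅ 13 8 3 = W₅+K₁ ⊕ g330 ∷ g303 ∷ []
recipeK₆-C₅ 13 8 5 = W₅+K₁ ⊕ g332 ∷ g303 ∷ []
recipeK₆-C₅ 13 8 7 = W₅+pendant ⊕ g222 ∷ g404 ∷ []
recipeK₆-C₅ 13 9 4 = W₅+K₁ ⊕ g321 ∷ g323 ∷ []
recipeK₆-C₅ 13 9 6 = W₅+K₁ ⊕ g222 ∷ g424 ∷ []
recipeK₆-C₅ 13 9 8 = W₅ ⊕ g222 ∷ g523 ∷ []
recipeK₆-C₅ 13 10 3 = W₅+K₁ ⊕ g222 ∷ g431 ∷ []
recipeK₆-C₅ 13 10 5 = W₅+K₁ ⊕ g222 ∷ g433 ∷ []
recipeK₆-C₅ 13 10 7 = W₅+pendant ⊕ g222 ∷ g424 ∷ []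
recipeK₆-C₅ 13 10 9 = W₅ ⊕ g332 ∷ g424 ∷ []
recipeK₆-C₅ 13 11 4 = W₅+K₁ ⊕ g222 ∷ g442 ∷ []
recipeK₆-C₅ 13 11 6 = W₅+pendant ⊕ g222 ∷ g433 ∷ []
recipeK₆-C₅ 13 11 8 = W₅ ⊕ g332 ∷ g433 ∷ []
recipeK₆-C₅ 13 11 10 = W₅ ⊕ g222 ∷ g222 ∷ g323 ∷ []
recipeK₆-C₅ 13 12 3 = W₅+pendant ⊕ g222 ∷ g440 ∷ []
recipeK₆-C₅ 13 12 5 = W₅+pendant ⊕ g222 ∷ g442 ∷ []
recipeK₆-C₅ 13 12 7 = W₅ ⊕ g332 ∷ g442 ∷ []
recipeK₆-C₅ 13 12 9 = W₅ ⊕ g222 ∷ g222 ∷ g332 ∷ []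
recipeK₆-C₅ _ _ _ = W₅ ⊕ []

recipeExceptional : ℕ → ℕ → ℕ → Recipe (edgeless 0)
recipeExceptional 6 5 5 = K₂ ⊕ g222 ∷ g222 ∷ []
recipeExceptional 7 5 4 = K̄₂ ⊕ g222 ∷ g332 ∷ []
recipeExceptional 7 6 3 = K₂ ⊕ g222 ∷ g330 ∷ []
recipeExceptional 7 6 5 = K₂ ⊕ g222 ∷ g332 ∷ []
recipeExceptional 8 5 3 = K̄₂ ⊕ g222 ∷ g431 ∷ []
recipeExceptional 8 5 5 = K̄₂ ⊕ g222 ∷ g433 ∷ []
recipeExceptional 8 6 4 = K̄₂ ⊕ g222 ∷ g442 ∷ []
recipeExceptional 8 6 6 = K₂ ⊕ g222 ∷ g433 ∷ []
recipeExceptional 8 7 3 = K₂ ⊕ g222 ∷ g440 ∷ []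
recipeExceptional 8 7 7 = K₂ ⊕ g222 ∷ g222 ∷ g222 ∷ []
recipeExceptional 9 5 4 = K̄₂ ⊕ g330 ∷ g424 ∷ []
recipeExceptional 9 6 3 = K̄₂ ⊕ g330 ∷ g433 ∷ []
recipeExceptional 9 8 7 = K₂ ⊕ g222 ∷ g222 ∷ g332 ∷ []
recipeExceptional 10 8 8 = K₂ ⊕ g222 ∷ g222 ∷ g433 ∷ []
recipeExceptional 10 9 9 = K₂ ⊕ g222 ∷ g222 ∷ g222 ∷ g222 ∷ []
recipeExceptional 11 10 9 = K₂ ⊕ g222 ∷ g222 ∷ g222 ∷ g332 ∷ []
recipeExceptional 12 10 10 = K₂ ⊕ g222 ∷ g222 ∷ g222 ∷ g433 ∷ []
recipeExceptional 12 11 11 = K₂ ⊕ g222 ∷ g222 ∷ g222 ∷ g222 ∷ g222 ∷ []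
recipeExceptional 13 12 11 = K₂ ⊕ g222 ∷ g222 ∷ g222 ∷ g222 ∷ g332 ∷ []
recipeExceptional _ _ _ = K₂ ⊕ []

recipeK₆-C₅-covers : Covers {P = λ n d₁ d₂ → Admissible n d₁ d₂ × Unexceptional n d₁ d₂} recipeK₆-C₅ 14
recipeK₆-C₅-covers = toWitness {a? = covers? recipeK₆-C₅ (λ n d₁ d₂ → admissible? n d₁ d₂ ×-dec unexceptional? n d₁ d₂) 14} _

recipeExceptional-covers : Covers {P = λ n d₁ d₂ → Admissible n d₁ d₂ × ¬ Unexceptional n d₁ d₂} recipeExceptional 14
recipeExceptional-covers =
  toWitness {a? = covers? recipeExceptional (λ n d₁ d₂ → admissible? n d₁ d₂ ×-dec ¬? (unexceptional? n d₁ d₂)) 14} _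

small-K₆-C₅ : ∀ {n d₁ d₂} → n ≤ 13 → Admissible n d₁ d₂ → Unexceptional n d₁ d₂ → Realization K6-C5 n d₁ d₂
small-K₆-C₅ n≤13 adm u =
  let d₁<14 , d₂<14 = admissible-bounded n≤13 adm in
  realize-covered recipeK₆-C₅ recipeK₆-C₅-covers (s≤s n≤13) d₁<14 d₂<14 (adm , u)

small-graphic : ∀ {n d₁ d₂} → n ≤ 13 → Admissible n d₁ d₂ → ⊤ → Realization (edgeless 0) n d₁ d₂
small-graphic {n} {d₁} {d₂} n≤13 adm _ with unexceptional? n d₁ d₂
... | yes u = forget (small-K₆-C₅ n≤13 adm u)
... | no ¬u =
  let d₁<14 , d₂<14 = admissible-bounded n≤13 adm in
  realize-covered recipeExceptional recipeExceptional-covers (s≤s n≤13) d₁<14 d₂<14 (adm , ¬u)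

lemma2p10 : ∀ (n d₁ d₂ : ℕ) → 6 ≤ n → d₁ ≤ n ∸ 1 → d₂ ≤ d₁ → 3 ≤ d₂ → 5 ≤ d₁
    → 2 ∣ σπ n d₁ d₂
    → Graphic (seqπ n d₁ d₂)
      × ((7 ≤ n → 2 ∣ n → ¬ (d₁ ≡ n ∸ 1 × d₂ ≡ n ∸ 1) × ¬ (d₁ ≡ n ∸ 2 × d₂ ≡ n ∸ 2))
         → (7 ≤ n → ¬ (2 ∣ n) → ¬ (d₁ ≡ n ∸ 1 × d₂ ≡ n ∸ 2))
         → ¬ ((n , d₁ , d₂) ∈ exceptions)
         → PotentiallyGraphic K6-C5 (seqπ n d₁ d₂))
lemma2p10 n d₁ d₂ n≥6 d₁≤n∸1 d₂≤d₁ d₂≥3 d₁≥5 σ-even =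
    graphic (realize trivial-hereditary small-graphic n adm tt)
  , λ even-case odd-case unlisted → potentiallyGraphic
      (realize unexceptional-hereditary small-K₆-C₅ n adm (mkUnexceptional even-case odd-case unlisted))
  where
  adm = mkAdmissible n≥6 d₁≤n∸1 d₂≤d₁ d₂≥3 d₁≥5 σ-even
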